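{- Let $d_1,d_2,t\in\mathbf{Z}$ with neither $d_1$ nor $d_2$ a perfect square and $t^2-d_1d_2\ne0$, and let $C_{d_1,d_2,t}=\{(x,y)\in\mathbf{R}^2:d_2x^2+d_1y^2-2txy=1\}$. Let $Q_i(X,Y)=A_iX^2+B_iXY+C_iY^2$ ($i=1,2$) have integer coefficients with $B_1^2-4A_1C_1=d_1$, $B_2^2-4A_2C_2=d_2$, $B_1B_2-2A_1C_2-2A_2C_1=t$, and assume $A_1B_2-A_2B_1\ne0$. Define $$R(X,Y)=(A_1B_2-A_2B_1)X^2+2XY(A_1C_2-A_2C_1)+Y^2(B_1C_2-B_2C_1).$$ Then for $x,y\in\mathbf{Q}$ the following are equivalent: (i) $(x,y)\in C_{d_1,d_2,t}$; (ii) there exist $a,b\in\mathbf{Q}$ with $R(a,b)\ne0$ such that $x=\frac{Q_1(a,b)}{R(a,b)}$ and $y=\frac{Q_2(a,b)}{R(a,b)}$. -}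

module Defs where

open import Data.Integer as ℤ using (ℤ)
open import Data.Rational as ℚ using (ℚ; _/_)
open import Data.Product using (Σ; ∃-syntax; _×_; _,_)
open import Data.Sum using (_⊎_)
open import Relation.Binary.PropositionalEquality using (_≡_; _≢_)
open import Relation.Nullary using (¬_)
open import Function.Bundles using (_⇔_)

IsSquare : ℤ → Set
IsSquare d = ∃[ k ] (k ℤ.* k ≡ d)

ι : ℤ → ℚ
ι z = z / 1

QF : ℤ → ℤ → ℤ → ℚ → ℚ → ℚ
QF A B C X Y = ι A ℚ.* X ℚ.* X ℚ.+ ι B ℚ.* X ℚ.* Y ℚ.+ ι C ℚ.* Y ℚ.* Y

Rform : ℤ → ℤ → ℤ → ℤ → ℤ → ℤ → ℚ → ℚ → ℚ
Rform A₁ B₁ C₁ A₂ B₂ C₂ X Y =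
  ι (A₁ ℤ.* B₂ ℤ.- A₂ ℤ.* B₁) ℚ.* X ℚ.* X
  ℚ.+ ι (ℤ.+ 2) ℚ.* X ℚ.* Y ℚ.* ι (A₁ ℤ.* C₂ ℤ.- A₂ ℤ.* C₁)
  ℚ.+ Y ℚ.* Y ℚ.* ι (B₁ ℤ.* C₂ ℤ.- B₂ ℤ.* C₁)

OnCurve : ℤ → ℤ → ℤ → ℚ → ℚ → Set
OnCurve d₁ d₂ t x y =
  ι d₂ ℚ.* x ℚ.* x ℚ.+ ι d₁ ℚ.* y ℚ.* y ℚ.- ι (ℤ.+ 2) ℚ.* ι t ℚ.* x ℚ.* y ≡ ℚ.1ℚ

Param : ℤ → ℤ → ℤ → ℤ → ℤ → ℤ → ℚ → ℚ → Set
Param A₁ B₁ C₁ A₂ B₂ C₂ x y =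
  ∃[ a ] ∃[ b ] Σ (Rform A₁ B₁ C₁ A₂ B₂ C₂ a b ≢ ℚ.0ℚ) λ nz →
    let r = Rform A₁ B₁ C₁ A₂ B₂ C₂ a b in
    (x ≡ ℚ._÷_ (QF A₁ B₁ C₁ a b) r {{ℚ.≢-nonZero nz}}) ×
    (y ≡ ℚ._÷_ (QF A₂ B₂ C₂ a b) r {{ℚ.≢-nonZero nz}})

{-# OPTIONS --safe #-}
-- The map (X : Y) ↦ (Q₁ : Q₂ : R) is the Veronese map (X : Y) ↦ (X² : XY : Y²), whose image is
-- the conic uw = v², followed by the linear map M whose rows are the coefficient vectors
-- (a₁, b₁, c₁), (a₂, b₂, c₂), (α, 2β, γ) of Q₁, Q₂ and R. With F(x, y, z) = d₂x² + d₁y² − 2txy − z²,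
-- the polynomial identity F ∘ M = (t² − d₁d₂)(uw − v²) gives both directions. On the Veronese conic
-- it says F(Q₁, Q₂, R) = 0, i.e. R² = d₂Q₁² + d₁Q₂² − 2tQ₁Q₂, so (Q₁/R, Q₂/R) lies on the curve.
-- Conversely det M = −(t² − d₁d₂)/2 ≠ 0, so for (x, y) on the curve the point p = adj(M)(x, y, 1)
-- satisfies Mp = det M · (x, y, 1), hence F(Mp) = 0 and p lies on the conic uw = v². Such a point
-- is a nonzero multiple of (X², XY, Y²) for (X, Y) = (u, v) or (v, w), and then (Q₁ : Q₂ : R)(X, Y)
-- is proportional to (x, y, 1).

module Submission where

open import Defs
open import Data.Product using (∃-syntax; _×_; _,_)
open import Data.Sum using (_⊎_; inj₁; inj₂)
open import Function using (_∘_)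
open import Function.Bundles using (_⇔_; mk⇔; Equivalence)
open import Relation.Binary.PropositionalEquality
open import Relation.Nullary using (¬_; yes; no)

module RationalConics where
  open import Agda.Builtin.FromNat using (fromNat)
  open import Algebra.Properties.Group using (x∙y⁻¹≈ε⇒x≈y; x≈y⇒x∙y⁻¹≈ε)
  open import Data.List.Base using (_∷_; [])
  open import Data.Maybe.Base using (Maybe; just; nothing)
  open import Data.Rational.Base using (ℚ; 0ℚ; 1ℚ; _+_; _*_; _-_; -_; 1/_; _÷_; ≢-nonZero)
  open import Data.Rational.Literals using (number)
  open import Data.Rational.Properties
    using (_≟_; +-0-group; +-*-commutativeRing; *-assoc; *-comm; *-identityˡ; *-identityʳ;
           *-inverseˡ; *-inverseʳ; *-zeroʳ)
  open import Data.Unit.Base using (tt)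
  open import Level using (0ℓ)
  open import Tactic.RingSolver using (solve-∀; solve)
  open import Tactic.RingSolver.Core.AlmostCommutativeRing
    using (AlmostCommutativeRing; fromCommutativeRing)
  open ≡-Reasoning

  -- numerals in ℚ; literal overloading also needs fromNat in scope
  instance
    _ = number
    _ = tt

  ℚ-ring : AlmostCommutativeRing 0ℓ 0ℓ
  ℚ-ring = fromCommutativeRing +-*-commutativeRing isZero
    where
    isZero : ∀ p → Maybe (0ℚ ≡ p)
    isZero p with p ≟ 0ℚ
    ... | yes p≡0 = just (sym p≡0)
    ... | no _    = nothing

  p≡q⇔p-q≡0 : ∀ {p q} → p ≡ q ⇔ p - q ≡ 0ℚ
  p≡q⇔p-q≡0 = mk⇔ (x≈y⇒x∙y⁻¹≈ε +-0-group) (x∙y⁻¹≈ε⇒x≈y +-0-group _ _)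

  p*q≡0⇒q≡0 : ∀ {p q} → p ≢ 0ℚ → p * q ≡ 0ℚ → q ≡ 0ℚ
  p*q≡0⇒q≡0 {p} {q} p≢0 pq≡0 = begin
    q               ≡⟨ *-identityˡ q ⟨
    1ℚ * q          ≡⟨ cong (_* q) (*-inverseˡ p) ⟨
    1/ p * p * q    ≡⟨ *-assoc (1/ p) p q ⟩
    1/ p * (p * q)  ≡⟨ cong (1/ p *_) pq≡0 ⟩
    1/ p * 0ℚ       ≡⟨ *-zeroʳ (1/ p) ⟩
    0ℚ              ∎
    where instance _ = ≢-nonZero p≢0

  p*q≢0 : ∀ {p q} → p ≢ 0ℚ → q ≢ 0ℚ → p * q ≢ 0ℚ
  p*q≢0 p≢0 q≢0 = q≢0 ∘ p*q≡0⇒q≡0 p≢0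

  p*p≡0⇒p≡0 : ∀ {p} → p * p ≡ 0ℚ → p ≡ 0ℚ
  p*p≡0⇒p≡0 {p} pp≡0 with p ≟ 0ℚ
  ... | yes p≡0 = p≡0
  ... | no  p≢0 = p*q≡0⇒q≡0 p≢0 pp≡0

  ≡÷⇔≡* : ∀ {x p r} (r≢0 : r ≢ 0ℚ) → x ≡ (p ÷ r) {{≢-nonZero r≢0}} ⇔ p ≡ r * x
  ≡÷⇔≡* {x} {p} {r} r≢0 = mk⇔ (λ x≡p/r → sym (r*[p/r]≡p x≡p/r)) (λ p≡rx → sym ([rx]/r≡x p≡rx))
    where
    instance _ = ≢-nonZero r≢0
    r*[p/r]≡p : x ≡ p * 1/ r → r * x ≡ p
    r*[p/r]≡p refl = begin
      r * (p * 1/ r)  ≡⟨ cong (r *_) (*-comm p (1/ r)) ⟩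
      r * (1/ r * p)  ≡⟨ *-assoc r (1/ r) p ⟨
      r * 1/ r * p    ≡⟨ cong (_* p) (*-inverseʳ r) ⟩
      1ℚ * p          ≡⟨ *-identityˡ p ⟩
      p               ∎
    [rx]/r≡x : p ≡ r * x → p * 1/ r ≡ x
    [rx]/r≡x refl = begin
      r * x * 1/ r    ≡⟨ cong (_* 1/ r) (*-comm r x) ⟩
      x * r * 1/ r    ≡⟨ *-assoc x r (1/ r) ⟩
      x * (r * 1/ r)  ≡⟨ cong (x *_) (*-inverseʳ r) ⟩
      x * 1ℚ          ≡⟨ *-identityʳ x ⟩
      x               ∎

  quad : ℚ → ℚ → ℚ → ℚ → ℚ → ℚ
  quad a b c X Y = a * X * X + b * X * Y + c * Y * Y

  quad-veronese : ∀ a b c X Y → quad a b c X Y ≡ a * (X * X) + b * (X * Y) + c * (Y * Y)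
  quad-veronese a b c X Y = begin
    a * X * X + b * X * Y + c * Y * Y        ≡⟨ solve (a ∷ b ∷ c ∷ X ∷ Y ∷ []) ℚ-ring ⟩
    a * (X * X) + b * (X * Y) + c * (Y * Y)  ∎

  veronese-onConic : ∀ X Y → X * X * (Y * Y) ≡ X * Y * (X * Y)
  veronese-onConic = solve-∀ ℚ-ring

  quad-onConicˡ : ∀ {u v w} → u * w ≡ v * v →
    ∀ a b c → quad a b c u v ≡ u * (a * u + b * v + c * w)
  quad-onConicˡ {u} {v} {w} uw≡vv a b c = begin
    a * u * u + b * u * v + c * v * v        ≡⟨ solve (a ∷ b ∷ c ∷ u ∷ v ∷ []) ℚ-ring ⟩
    a * u * u + b * u * v + c * (v * v)      ≡⟨ cong (λ vv → a * u * u + b * u * v + c * vv) uw≡vv ⟨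
    a * u * u + b * u * v + c * (u * w)      ≡⟨ solve (a ∷ b ∷ c ∷ u ∷ v ∷ w ∷ []) ℚ-ring ⟩
    u * (a * u + b * v + c * w)              ∎

  quad-onConicʳ : ∀ {u v w} → u * w ≡ v * v →
    ∀ a b c → quad a b c v w ≡ w * (a * u + b * v + c * w)
  quad-onConicʳ {u} {v} {w} uw≡vv a b c = begin
    a * v * v + b * v * w + c * w * w        ≡⟨ solve (a ∷ b ∷ c ∷ v ∷ w ∷ []) ℚ-ring ⟩
    a * (v * v) + b * v * w + c * w * w      ≡⟨ cong (λ vv → a * vv + b * v * w + c * w * w) uw≡vv ⟨
    a * (u * w) + b * v * w + c * w * w      ≡⟨ solve (a ∷ b ∷ c ∷ u ∷ v ∷ w ∷ []) ℚ-ring ⟩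
    w * (a * u + b * v + c * w)              ∎

  onConic-≢0 : ∀ {u v w} a b c → u * w ≡ v * v → a * u + b * v + c * w ≢ 0ℚ →
    u ≢ 0ℚ ⊎ w ≢ 0ℚ
  onConic-≢0 {u} {v} a b c uw≡vv ℓ≢0 with u ≟ 0ℚ
  ... | no  u≢0 = inj₁ u≢0
  ... | yes refl = inj₂ λ where
    refl → ℓ≢0 (begin
      a * 0ℚ + b * v + c * 0ℚ    ≡⟨ cong (λ v → a * 0ℚ + b * v + c * 0ℚ) (p*p≡0⇒p≡0 (sym uw≡vv)) ⟩
      a * 0ℚ + b * 0ℚ + c * 0ℚ   ≡⟨ solve (a ∷ b ∷ c ∷ []) ℚ-ring ⟩
      0ℚ                         ∎)

  veronese-preimage : ∀ {u v w} → u * w ≡ v * v → u ≢ 0ℚ ⊎ w ≢ 0ℚ →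
    ∃[ X ] ∃[ Y ] ∃[ k ] (k ≢ 0ℚ × ∀ a b c → quad a b c X Y ≡ k * (a * u + b * v + c * w))
  veronese-preimage {u} {v} {w} uw≡vv (inj₁ u≢0) = u , v , u , u≢0 , quad-onConicˡ uw≡vv
  veronese-preimage {u} {v} {w} uw≡vv (inj₂ w≢0) = v , w , w , w≢0 , quad-onConicʳ uw≡vv

  cramer : ∀ a₁ b₁ c₁ a₂ b₂ c₂ a₃ b₃ c₃ x y z →
    let Δ = a₁ * (b₂ * c₃ - c₂ * b₃) + b₁ * (c₂ * a₃ - a₂ * c₃) + c₁ * (a₂ * b₃ - b₂ * a₃)
    in ∃[ u ] ∃[ v ] ∃[ w ] ( a₁ * u + b₁ * v + c₁ * w ≡ Δ * x
                            × a₂ * u + b₂ * v + c₂ * w ≡ Δ * y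
                            × a₃ * u + b₃ * v + c₃ * w ≡ Δ * z)
  cramer a₁ b₁ c₁ a₂ b₂ c₂ a₃ b₃ c₃ x y z =
    let u = x * (b₂ * c₃ - c₂ * b₃) + y * (b₃ * c₁ - c₃ * b₁) + z * (b₁ * c₂ - c₁ * b₂)
        v = x * (c₂ * a₃ - a₂ * c₃) + y * (c₃ * a₁ - a₃ * c₁) + z * (c₁ * a₂ - a₁ * c₂)
        w = x * (a₂ * b₃ - b₂ * a₃) + y * (a₃ * b₁ - b₃ * a₁) + z * (a₁ * b₂ - b₁ * a₂)
    in u , v , w , solve xs ℚ-ring , solve xs ℚ-ring , solve xs ℚ-ring
    where xs = a₁ ∷ b₁ ∷ c₁ ∷ a₂ ∷ b₂ ∷ c₂ ∷ a₃ ∷ b₃ ∷ c₃ ∷ x ∷ y ∷ z ∷ []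

  R-as-quad : ∀ α β γ X Y →
    α * X * X + 2 * X * Y * β + Y * Y * γ ≡ α * X * X + 2 * β * X * Y + γ * Y * Y
  R-as-quad = solve-∀ ℚ-ring

  curveForm : ℚ → ℚ → ℚ → ℚ → ℚ → ℚ → ℚ
  curveForm d₁ d₂ t x y z = d₂ * x * x + d₁ * y * y - 2 * t * x * y - z * z

  curveForm-scale : ∀ d₁ d₂ t k x y →
    let F x y z = d₂ * x * x + d₁ * y * y - 2 * t * x * y - z * z
    in F (k * x) (k * y) k ≡ k * k * F x y 1ℚ
  curveForm-scale = solve-∀ ℚ-ring

  cone⇔curve : ∀ d₁ d₂ t {k x y X₁ X₂ X₃} → k ≢ 0ℚ → X₁ ≡ k * x → X₂ ≡ k * y → X₃ ≡ k →
    curveForm d₁ d₂ t X₁ X₂ X₃ ≡ 0ℚ ⇔ curveForm d₁ d₂ t x y 1ℚ ≡ 0ℚ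
  cone⇔curve d₁ d₂ t {k} {x} {y} k≢0 refl refl refl = mk⇔
    (p*q≡0⇒q≡0 (p*q≢0 k≢0 k≢0) ∘ trans (sym (curveForm-scale d₁ d₂ t k x y)))
    (λ F≡0 → trans (curveForm-scale d₁ d₂ t k x y) (trans (cong (k * k *_) F≡0) (*-zeroʳ (k * k))))

  curveForm-pullback : ∀ a₁ b₁ c₁ a₂ b₂ c₂ u v w →
    let α = a₁ * b₂ - a₂ * b₁
        β = a₁ * c₂ - a₂ * c₁
        γ = b₁ * c₂ - b₂ * c₁
        d₁ = b₁ * b₁ - 4 * a₁ * c₁
        d₂ = b₂ * b₂ - 4 * a₂ * c₂
        t = b₁ * b₂ - 2 * a₁ * c₂ - 2 * a₂ * c₁
        F x y z = d₂ * x * x + d₁ * y * y - 2 * t * x * y - z * z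
    in F (a₁ * u + b₁ * v + c₁ * w) (a₂ * u + b₂ * v + c₂ * w) (α * u + 2 * β * v + γ * w)
         ≡ (t * t - d₁ * d₂) * (u * w - v * v)
  curveForm-pullback = solve-∀ ℚ-ring

  -- Δ is the determinant of the matrix with rows (a₁, b₁, c₁), (a₂, b₂, c₂), (α, 2β, γ), expanded
  -- along the first row as in cramer; t² − d₁d₂ is 4 Res(Q₁, Q₂).
  resultant-det : ∀ a₁ b₁ c₁ a₂ b₂ c₂ →
    let α = a₁ * b₂ - a₂ * b₁
        β = a₁ * c₂ - a₂ * c₁
        γ = b₁ * c₂ - b₂ * c₁
        d₁ = b₁ * b₁ - 4 * a₁ * c₁
        d₂ = b₂ * b₂ - 4 * a₂ * c₂
        t = b₁ * b₂ - 2 * a₁ * c₂ - 2 * a₂ * c₁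
        Δ = a₁ * (b₂ * γ - c₂ * (2 * β)) + b₁ * (c₂ * α - a₂ * γ) + c₁ * (a₂ * (2 * β) - b₂ * α)
    in t * t - d₁ * d₂ ≡ - (2 * Δ)
  resultant-det = solve-∀ ℚ-ring

  module Pencil (a₁ b₁ c₁ a₂ b₂ c₂ : ℚ) where
    α β γ d₁ d₂ t Δ : ℚ
    α = a₁ * b₂ - a₂ * b₁
    β = a₁ * c₂ - a₂ * c₁
    γ = b₁ * c₂ - b₂ * c₁
    d₁ = b₁ * b₁ - 4 * a₁ * c₁
    d₂ = b₂ * b₂ - 4 * a₂ * c₂
    t = b₁ * b₂ - 2 * a₁ * c₂ - 2 * a₂ * c₁
    Δ = a₁ * (b₂ * γ - c₂ * (2 * β)) + b₁ * (c₂ * α - a₂ * γ) + c₁ * (a₂ * (2 * β) - b₂ * α)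

    R : ℚ → ℚ → ℚ
    R = quad α (2 * β) γ

    Parametrised : ℚ → ℚ → Set
    Parametrised x y =
      ∃[ X ] ∃[ Y ] (R X Y ≢ 0ℚ × quad a₁ b₁ c₁ X Y ≡ R X Y * x × quad a₂ b₂ c₂ X Y ≡ R X Y * y)

    Δ≢0 : t * t - d₁ * d₂ ≢ 0ℚ → Δ ≢ 0ℚ
    Δ≢0 T≢0 Δ≡0 = T≢0 (trans (resultant-det a₁ b₁ c₁ a₂ b₂ c₂) (cong (λ δ → - (2 * δ)) Δ≡0))

    veronese⇒parametrised : ∀ {u v w k x y} → u * w ≡ v * v → k ≢ 0ℚ →
      a₁ * u + b₁ * v + c₁ * w ≡ k * x → a₂ * u + b₂ * v + c₂ * w ≡ k * y →
      α * u + 2 * β * v + γ * w ≡ k → Parametrised x y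
    veronese⇒parametrised {k = k} uw≡vv k≢0 ℓ₁≡kx ℓ₂≡ky ℓ₃≡k
      with veronese-preimage uw≡vv (onConic-≢0 α (2 * β) γ uw≡vv (k≢0 ∘ trans (sym ℓ₃≡k)))
    ... | X , Y , m , m≢0 , image =
      X , Y , p*q≢0 m≢0 k≢0 ∘ trans (sym R≡mk) ,
      proportional (image a₁ b₁ c₁) ℓ₁≡kx , proportional (image a₂ b₂ c₂) ℓ₂≡ky
      where
      R≡mk : R X Y ≡ m * k
      R≡mk = trans (image α (2 * β) γ) (cong (m *_) ℓ₃≡k)
      proportional : ∀ {Q ℓ z} → Q ≡ m * ℓ → ℓ ≡ k * z → Q ≡ R X Y * z
      proportional {Q} {ℓ} {z} Q≡mℓ ℓ≡kz = begin
        Q            ≡⟨ Q≡mℓ ⟩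
        m * ℓ        ≡⟨ cong (m *_) ℓ≡kz ⟩
        m * (k * z)  ≡⟨ *-assoc m k z ⟨
        m * k * z    ≡⟨ cong (_* z) R≡mk ⟨
        R X Y * z    ∎

    curve⇒parametrised : t * t - d₁ * d₂ ≢ 0ℚ →
      ∀ {x y} → curveForm d₁ d₂ t x y 1ℚ ≡ 0ℚ → Parametrised x y
    curve⇒parametrised T≢0 {x} {y} F≡0 =
      adjugate⇒parametrised (cramer a₁ b₁ c₁ a₂ b₂ c₂ α (2 * β) γ x y 1ℚ)
      where
      adjugate⇒parametrised : ∃[ u ] ∃[ v ] ∃[ w ] ( a₁ * u + b₁ * v + c₁ * w ≡ Δ * x
                                                   × a₂ * u + b₂ * v + c₂ * w ≡ Δ * y
                                                   × α * u + 2 * β * v + γ * w ≡ Δ * 1ℚ) →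
        Parametrised x y
      adjugate⇒parametrised (u , v , w , ℓ₁≡Δx , ℓ₂≡Δy , ℓ₃≡Δ1) =
        veronese⇒parametrised uw≡vv (Δ≢0 T≢0) ℓ₁≡Δx ℓ₂≡Δy ℓ₃≡Δ
        where
        ℓ₃≡Δ : α * u + 2 * β * v + γ * w ≡ Δ
        ℓ₃≡Δ = trans ℓ₃≡Δ1 (*-identityʳ Δ)
        uw≡vv : u * w ≡ v * v
        uw≡vv = Equivalence.from p≡q⇔p-q≡0 (p*q≡0⇒q≡0 T≢0 (begin
          (t * t - d₁ * d₂) * (u * w - v * v)
            ≡⟨ curveForm-pullback a₁ b₁ c₁ a₂ b₂ c₂ u v w ⟨
          curveForm d₁ d₂ t (a₁ * u + b₁ * v + c₁ * w) (a₂ * u + b₂ * v + c₂ * w) (α * u + 2 * β * v + γ * w)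
            ≡⟨ Equivalence.from (cone⇔curve d₁ d₂ t (Δ≢0 T≢0) ℓ₁≡Δx ℓ₂≡Δy ℓ₃≡Δ) F≡0 ⟩
          0ℚ ∎))

    veronese-onCone : ∀ X Y → curveForm d₁ d₂ t (a₁ * (X * X) + b₁ * (X * Y) + c₁ * (Y * Y))
                                                (a₂ * (X * X) + b₂ * (X * Y) + c₂ * (Y * Y))
                                                (α * (X * X) + 2 * β * (X * Y) + γ * (Y * Y)) ≡ 0ℚ
    veronese-onCone X Y = begin
      curveForm d₁ d₂ t (a₁ * (X * X) + b₁ * (X * Y) + c₁ * (Y * Y))
                        (a₂ * (X * X) + b₂ * (X * Y) + c₂ * (Y * Y))
                        (α * (X * X) + 2 * β * (X * Y) + γ * (Y * Y))
        ≡⟨ curveForm-pullback a₁ b₁ c₁ a₂ b₂ c₂ (X * X) (X * Y) (Y * Y) ⟩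
      (t * t - d₁ * d₂) * (X * X * (Y * Y) - X * Y * (X * Y))
        ≡⟨ cong ((t * t - d₁ * d₂) *_) (Equivalence.to p≡q⇔p-q≡0 (veronese-onConic X Y)) ⟩
      (t * t - d₁ * d₂) * 0ℚ
        ≡⟨ *-zeroʳ (t * t - d₁ * d₂) ⟩
      0ℚ ∎

    parametrised⇒curve : ∀ {x y} → Parametrised x y → curveForm d₁ d₂ t x y 1ℚ ≡ 0ℚ
    parametrised⇒curve (X , Y , R≢0 , Q₁≡Rx , Q₂≡Ry) = Equivalence.to
      (cone⇔curve d₁ d₂ t R≢0 (trans (sym (quad-veronese a₁ b₁ c₁ X Y)) Q₁≡Rx)
                              (trans (sym (quad-veronese a₂ b₂ c₂ X Y)) Q₂≡Ry)
                              (sym (quad-veronese α (2 * β) γ X Y)))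
      (veronese-onCone X Y)

    curve⇔parametrised : t * t - d₁ * d₂ ≢ 0ℚ →
      ∀ {x y} → curveForm d₁ d₂ t x y 1ℚ ≡ 0ℚ ⇔ Parametrised x y
    curve⇔parametrised T≢0 = mk⇔ (curve⇒parametrised T≢0) parametrised⇒curve

open RationalConics using (curveForm; p≡q⇔p-q≡0; ≡÷⇔≡*; R-as-quad; module Pencil)
open import Data.Integer as ℤ using (ℤ; +_; _-_)
import Data.Integer.Properties as ℤ
open import Data.Rational using (ℚ)
import Data.Rational as ℚ
open import Data.Rational.Properties
  using (toℚᵘ-injective; fromℚᵘ-injective; toℚᵘ-fromℚᵘ; toℚᵘ-homo-+; toℚᵘ-homo-*; toℚᵘ-homo‿-)
open import Data.Rational.Unnormalised.Base as ℚᵘ using (mkℚᵘ; *≡*)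
import Data.Rational.Unnormalised.Properties as ℚᵘ
open import Function.Properties.Equivalence using (⇔-setoid)
open import Level using (0ℓ)
import Relation.Binary.Reasoning.Setoid as SetoidReasoning

toℚᵘ-ι : ∀ a → ℚ.toℚᵘ (ι a) ℚᵘ.≃ mkℚᵘ a 0
toℚᵘ-ι a = toℚᵘ-fromℚᵘ (mkℚᵘ a 0)

ι-injective : ∀ {a b} → ι a ≡ ι b → a ≡ b
ι-injective {a} {b} ιa≡ιb with fromℚᵘ-injective {mkℚᵘ a 0} {mkℚᵘ b 0} ιa≡ιb
... | *≡* a*1≡b*1 = ℤ.*-cancelʳ-≡ a b (+ 1) a*1≡b*1

ι-homo-+ : ∀ a b → ι (a ℤ.+ b) ≡ ι a ℚ.+ ι b
ι-homo-+ a b = toℚᵘ-injective (begin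
  ℚ.toℚᵘ (ι (a ℤ.+ b))            ≈⟨ toℚᵘ-ι (a ℤ.+ b) ⟩
  mkℚᵘ (a ℤ.+ b) 0                ≈⟨ ℚᵘ.≃-reflexive (cong (λ n → mkℚᵘ n 0) a*1+b*1≡a+b) ⟨
  mkℚᵘ a 0 ℚᵘ.+ mkℚᵘ b 0          ≈⟨ ℚᵘ.+-cong (toℚᵘ-ι a) (toℚᵘ-ι b) ⟨
  ℚ.toℚᵘ (ι a) ℚᵘ.+ ℚ.toℚᵘ (ι b)  ≈⟨ toℚᵘ-homo-+ (ι a) (ι b) ⟨
  ℚ.toℚᵘ (ι a ℚ.+ ι b)            ∎)
  where
  open ℚᵘ.≃-Reasoning
  a*1+b*1≡a+b : a ℤ.* + 1 ℤ.+ b ℤ.* + 1 ≡ a ℤ.+ b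
  a*1+b*1≡a+b = cong₂ ℤ._+_ (ℤ.*-identityʳ a) (ℤ.*-identityʳ b)

ι-homo-* : ∀ a b → ι (a ℤ.* b) ≡ ι a ℚ.* ι b
ι-homo-* a b = toℚᵘ-injective (begin
  ℚ.toℚᵘ (ι (a ℤ.* b))            ≈⟨ toℚᵘ-ι (a ℤ.* b) ⟩
  mkℚᵘ a 0 ℚᵘ.* mkℚᵘ b 0          ≈⟨ ℚᵘ.*-cong (toℚᵘ-ι a) (toℚᵘ-ι b) ⟨
  ℚ.toℚᵘ (ι a) ℚᵘ.* ℚ.toℚᵘ (ι b)  ≈⟨ toℚᵘ-homo-* (ι a) (ι b) ⟨
  ℚ.toℚᵘ (ι a ℚ.* ι b)            ∎)
  where open ℚᵘ.≃-Reasoning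

ι-homo‿- : ∀ a → ι (ℤ.- a) ≡ ℚ.- ι a
ι-homo‿- a = toℚᵘ-injective (begin
  ℚ.toℚᵘ (ι (ℤ.- a))   ≈⟨ toℚᵘ-ι (ℤ.- a) ⟩
  ℚᵘ.- mkℚᵘ a 0        ≈⟨ ℚᵘ.-‿cong (toℚᵘ-ι a) ⟨
  ℚᵘ.- ℚ.toℚᵘ (ι a)    ≈⟨ toℚᵘ-homo‿- (ι a) ⟨
  ℚ.toℚᵘ (ℚ.- ι a)     ∎)
  where open ℚᵘ.≃-Reasoning

ι-homo-minus : ∀ a b → ι (a - b) ≡ ι a ℚ.- ι b
ι-homo-minus a b = trans (ι-homo-+ a (ℤ.- b)) (cong (ι a ℚ.+_) (ι-homo‿- b))

ι-homo-ab-cd : ∀ a b c d → ι (a ℤ.* b - c ℤ.* d) ≡ ι a ℚ.* ι b ℚ.- ι c ℚ.* ι d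
ι-homo-ab-cd a b c d =
  trans (ι-homo-minus (a ℤ.* b) (c ℤ.* d)) (cong₂ ℚ._-_ (ι-homo-* a b) (ι-homo-* c d))

ι-homo-kab : ∀ k a b → ι (k ℤ.* a ℤ.* b) ≡ ι k ℚ.* ι a ℚ.* ι b
ι-homo-kab k a b = trans (ι-homo-* (k ℤ.* a) b) (cong (ℚ._* ι b) (ι-homo-* k a))

ι-discriminant : ∀ A B C →
  ι (B ℤ.* B - + 4 ℤ.* A ℤ.* C) ≡ ι B ℚ.* ι B ℚ.- ι (+ 4) ℚ.* ι A ℚ.* ι C
ι-discriminant A B C =
  trans (ι-homo-minus (B ℤ.* B) (+ 4 ℤ.* A ℤ.* C)) (cong₂ ℚ._-_ (ι-homo-* B B) (ι-homo-kab (+ 4) A C))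

OnCurve⇔curveForm : ∀ d₁ d₂ t {δ₁ δ₂ τ} → ι d₁ ≡ δ₁ → ι d₂ ≡ δ₂ → ι t ≡ τ →
  ∀ x y → OnCurve d₁ d₂ t x y ⇔ curveForm δ₁ δ₂ τ x y ℚ.1ℚ ≡ ℚ.0ℚ
OnCurve⇔curveForm d₁ d₂ t refl refl refl x y = p≡q⇔p-q≡0

module _ (A₁ B₁ C₁ A₂ B₂ C₂ : ℤ) where
  open Pencil (ι A₁) (ι B₁) (ι C₁) (ι A₂) (ι B₂) (ι C₂)

  ι-mixedDiscriminant : ι (B₁ ℤ.* B₂ - + 2 ℤ.* A₁ ℤ.* C₂ - + 2 ℤ.* A₂ ℤ.* C₁) ≡ t
  ι-mixedDiscriminant =
    trans (ι-homo-minus (B₁ ℤ.* B₂ - + 2 ℤ.* A₁ ℤ.* C₂) (+ 2 ℤ.* A₂ ℤ.* C₁))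
      (cong₂ ℚ._-_ (trans (ι-homo-minus (B₁ ℤ.* B₂) (+ 2 ℤ.* A₁ ℤ.* C₂))
                          (cong₂ ℚ._-_ (ι-homo-* B₁ B₂) (ι-homo-kab (+ 2) A₁ C₂)))
                   (ι-homo-kab (+ 2) A₂ C₁))

  Rform≡R : ∀ X Y → Rform A₁ B₁ C₁ A₂ B₂ C₂ X Y ≡ R X Y
  Rform≡R X Y
    rewrite ι-homo-ab-cd A₁ B₂ A₂ B₁ | ι-homo-ab-cd A₁ C₂ A₂ C₁ | ι-homo-ab-cd B₁ C₂ B₂ C₁
    = R-as-quad α β γ X Y

  Param⇔Parametrised : ∀ {x y} → Param A₁ B₁ C₁ A₂ B₂ C₂ x y ⇔ Parametrised x y
  Param⇔Parametrised = mk⇔ toParametrised toParam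
    where
    open Equivalence
    toParametrised : ∀ {x y} → Param A₁ B₁ C₁ A₂ B₂ C₂ x y → Parametrised x y
    toParametrised (X , Y , Rform≢0 , x≡Q₁/R , y≡Q₂/R) =
      X , Y , Rform≢0 ∘ trans (Rform≡R X Y) ,
      withR (to (≡÷⇔≡* Rform≢0) x≡Q₁/R) , withR (to (≡÷⇔≡* Rform≢0) y≡Q₂/R)
      where
      withR : ∀ {Q z} → Q ≡ Rform A₁ B₁ C₁ A₂ B₂ C₂ X Y ℚ.* z → Q ≡ R X Y ℚ.* z
      withR {Q} {z} = subst (λ r → Q ≡ r ℚ.* z) (Rform≡R X Y)
    toParam : ∀ {x y} → Parametrised x y → Param A₁ B₁ C₁ A₂ B₂ C₂ x y
    toParam (X , Y , R≢0 , Q₁≡Rx , Q₂≡Ry) =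
      X , Y , Rform≢0 ,
      from (≡÷⇔≡* Rform≢0) (withRform Q₁≡Rx) , from (≡÷⇔≡* Rform≢0) (withRform Q₂≡Ry)
      where
      Rform≢0 : Rform A₁ B₁ C₁ A₂ B₂ C₂ X Y ≢ ℚ.0ℚ
      Rform≢0 = R≢0 ∘ trans (sym (Rform≡R X Y))
      withRform : ∀ {Q z} → Q ≡ R X Y ℚ.* z → Q ≡ Rform A₁ B₁ C₁ A₂ B₂ C₂ X Y ℚ.* z
      withRform {Q} {z} = subst (λ r → Q ≡ r ℚ.* z) (sym (Rform≡R X Y))

lemma3p3 : (d₁ d₂ t : ℤ) → ¬ IsSquare d₁ → ¬ IsSquare d₂ →
           t ℤ.* t - d₁ ℤ.* d₂ ≢ + 0 →
           (A₁ B₁ C₁ A₂ B₂ C₂ : ℤ) →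
           B₁ ℤ.* B₁ - + 4 ℤ.* A₁ ℤ.* C₁ ≡ d₁ →
           B₂ ℤ.* B₂ - + 4 ℤ.* A₂ ℤ.* C₂ ≡ d₂ →
           B₁ ℤ.* B₂ - + 2 ℤ.* A₁ ℤ.* C₂ - + 2 ℤ.* A₂ ℤ.* C₁ ≡ t →
           A₁ ℤ.* B₂ - A₂ ℤ.* B₁ ≢ + 0 →
           (x y : ℚ) →
           OnCurve d₁ d₂ t x y ⇔ Param A₁ B₁ C₁ A₂ B₂ C₂ x y
lemma3p3 d₁ d₂ t _ _ T≢0 A₁ B₁ C₁ A₂ B₂ C₂ refl refl refl _ x y = begin
  OnCurve d₁ d₂ t x y                        ≈⟨ OnCurve⇔curveForm d₁ d₂ t ι-d₁ ι-d₂ ι-t x y ⟩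
  curveForm P.d₁ P.d₂ P.t x y ℚ.1ℚ ≡ ℚ.0ℚ    ≈⟨ P.curve⇔parametrised (T≢0 ∘ ι-injective ∘ trans ι-T) ⟩
  P.Parametrised x y                         ≈⟨ Param⇔Parametrised A₁ B₁ C₁ A₂ B₂ C₂ ⟨
  Param A₁ B₁ C₁ A₂ B₂ C₂ x y                ∎
  where
  open SetoidReasoning (⇔-setoid 0ℓ)
  module P = Pencil (ι A₁) (ι B₁) (ι C₁) (ι A₂) (ι B₂) (ι C₂)
  ι-d₁ : ι d₁ ≡ P.d₁
  ι-d₁ = ι-discriminant A₁ B₁ C₁
  ι-d₂ : ι d₂ ≡ P.d₂
  ι-d₂ = ι-discriminant A₂ B₂ C₂
  ι-t : ι t ≡ P.t
  ι-t = ι-mixedDiscriminant A₁ B₁ C₁ A₂ B₂ C₂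
  ι-T : ι (t ℤ.* t - d₁ ℤ.* d₂) ≡ P.t ℚ.* P.t ℚ.- P.d₁ ℚ.* P.d₂
  ι-T = trans (ι-homo-ab-cd t t d₁ d₂) (cong₂ ℚ._-_ (cong₂ ℚ._*_ ι-t ι-t) (cong₂ ℚ._*_ ι-d₁ ι-d₂))
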